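{- Let $a,b,c,d\in\mathbb{Z}$ with $a\neq 0$, and consider the surface $\mathcal{S}: x^2+ay^5+by-(z^6+cz)=d$. Then the set of rational points on $\mathcal{S}$ is infinite. -}

module Defs where

open import Data.Integer using (ℤ)
open import Data.Product using (_×_; _,_)
open import Data.Rational using (ℚ; _+_; _*_; _-_; _/_)
open import Relation.Binary.PropositionalEquality using (_≡_)

ℤ→ℚ : ℤ → ℚ
ℤ→ℚ n = n / 1

OnSurface : ℤ → ℤ → ℤ → ℤ → ℚ × ℚ × ℚ → Set
OnSurface a b c d (x , y , z) =
  (x * x) + ℤ→ℚ a * (y * y * y * y * y) + ℤ→ℚ b * y
    - ((z * z * z * z * z * z) + ℤ→ℚ c * z)
  ≡ ℤ→ℚ d

-- Along the curve x = z³ − 16uz² + 192u²z + 512u³, y = 2j(z − 4u) with u = a j⁵, the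
-- equation of the surface becomes linear in z, with slope c₁ and intercept c₀ integer
-- polynomials in a, b, c, d, j. For j = a t the parameter u = a⁶t⁵ is a natural number, and
-- once t exceeds 8|b| + |c| + |d| the leading terms 237568u⁵ and 229376u⁶ make c₁ and c₀
-- positive, so z = −c₀/c₁ gives a rational point for every such t. If the parameters s < t
-- gave the same point, comparing y-coordinates over the common z would force
-- s(c₀ + 4u(s)c₁) = t(c₀ + 4u(t)c₁) for the coefficients of t, but the right side is larger.

module Submission where

open import Agda.Builtin.FromNat using (Number; fromNat)
open import Data.Empty using (⊥-elim)
open import Data.Integer as ℤ using (ℤ; +_; +[1+_]; -[1+_]; 0ℤ; ∣_∣)
import Data.Integer.Properties as ℤ
import Data.Integer.Tactic.RingSolver as ℤ-Solver
open import Data.Nat as ℕ using (ℕ; zero; suc; z≤n)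
import Data.Nat.Coprimality as Coprime
import Data.Nat.Literals as ℕ
import Data.Nat.Properties as ℕ
import Data.Nat.Tactic.RingSolver as ℕ-Solver
open import Data.Product using (_×_; _,_; Σ; proj₁; proj₂)
open import Data.Rational as ℚ using (ℚ; 0ℚ; _+_; _*_; _-_; -_; 1/_; ↥_)
import Data.Rational.Literals as ℚ
import Data.Rational.Properties as ℚ
open import Algebra.Properties.CommutativeSemigroup ℕ.*-commutativeSemigroup using (x∙yz≈y∙xz)
open import Algebra.Properties.Group ℚ.+-0-group using () renaming (∙-cancelˡ to +-cancelˡ)
open import Data.Unit using (⊤; tt)
open import Defs
open import Function.Base using (_∘_)
open import Function.Definitions using (Injective)
open import Level using (0ℓ)
open import Relation.Binary.Definitions using (Tri; tri<; tri≈; tri>)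
open import Relation.Binary.PropositionalEquality hiding (J)
open import Relation.Nullary using (¬_)
open import Relation.Nullary.Decidable using (dec⇒maybe)
open import Tactic.RingSolver using (solve-∀)
open import Tactic.RingSolver.Core.AlmostCommutativeRing
  using (AlmostCommutativeRing; fromCommutativeRing)

instance
  literal-constraint : ⊤
  literal-constraint = tt
  ℕ-literals : Number ℕ
  ℕ-literals = ℕ.number
  ℚ-literals : Number ℚ
  ℚ-literals = ℚ.number

ℚ-ring : AlmostCommutativeRing 0ℓ 0ℓ
ℚ-ring = fromCommutativeRing ℚ.+-*-commutativeRing (λ q → dec⇒maybe (0ℚ ℚ.≟ q))

-- The solver rings' powers are the only ones solve-∀ recognises; they are left-nested
-- without a trailing 1, so y ^ 5 unfolds to the y * y * y * y * y of OnSurface.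
open AlmostCommutativeRing ℚ-ring using (_^_)
open AlmostCommutativeRing ℤ-Solver.ring using () renaming (_^_ to _^ℤ_)
open AlmostCommutativeRing ℕ-Solver.ring using () renaming (_^_ to _^ℕ_)

ℤ→ℚ≡fromℤ : ∀ i → ℤ→ℚ i ≡ ℚ.fromℤ i
ℤ→ℚ≡fromℤ (+ n)    = ℚ.normalize-coprime {n} {0} (Coprime.sym (Coprime.1-coprimeTo n))
ℤ→ℚ≡fromℤ -[1+ n ] =
  cong -_ (ℚ.normalize-coprime {suc n} {0} (Coprime.sym (Coprime.1-coprimeTo (suc n))))

ℤ→ℚ-injective : ∀ {i j} → ℤ→ℚ i ≡ ℤ→ℚ j → i ≡ j
ℤ→ℚ-injective {i} {j} eq = cong ↥_ (trans (sym (ℤ→ℚ≡fromℤ i)) (trans eq (ℤ→ℚ≡fromℤ j)))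

ℤ→ℚ-+ : ∀ i j → ℤ→ℚ (i ℤ.+ j) ≡ ℤ→ℚ i + ℤ→ℚ j
ℤ→ℚ-+ i j rewrite ℤ→ℚ≡fromℤ i | ℤ→ℚ≡fromℤ j =
  cong (ℚ._/ 1) (sym (cong₂ ℤ._+_ (ℤ.*-identityʳ i) (ℤ.*-identityʳ j)))

ℤ→ℚ-* : ∀ i j → ℤ→ℚ (i ℤ.* j) ≡ ℤ→ℚ i * ℤ→ℚ j
ℤ→ℚ-* i j rewrite ℤ→ℚ≡fromℤ i | ℤ→ℚ≡fromℤ j = refl

ℤ→ℚ-neg : ∀ i → ℤ→ℚ (ℤ.- i) ≡ - ℤ→ℚ i
ℤ→ℚ-neg (+ zero)  = refl
ℤ→ℚ-neg +[1+ n ]  = refl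
ℤ→ℚ-neg -[1+ n ]  = trans (ℤ→ℚ≡fromℤ +[1+ n ]) (sym (cong -_ (ℤ→ℚ≡fromℤ -[1+ n ])))

ℤ→ℚ-- : ∀ i j → ℤ→ℚ (i ℤ.- j) ≡ ℤ→ℚ i - ℤ→ℚ j
ℤ→ℚ-- i j = trans (ℤ→ℚ-+ i (ℤ.- j)) (cong (_+_ (ℤ→ℚ i)) (ℤ→ℚ-neg j))

ℤ→ℚ-^ : ∀ i n → ℤ→ℚ (i ^ℤ n) ≡ ℤ→ℚ i ^ n
ℤ→ℚ-^ i 0             = refl
ℤ→ℚ-^ i 1             = refl
ℤ→ℚ-^ i (suc (suc n)) = trans (ℤ→ℚ-* (i ^ℤ suc n) i) (cong (_* ℤ→ℚ i) (ℤ→ℚ-^ i (suc n)))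

pos-^ : ∀ m n → + (m ^ℕ n) ≡ (+ m) ^ℤ n
pos-^ m 0             = refl
pos-^ m 1             = refl
pos-^ m (suc (suc n)) = trans (ℤ.pos-* (m ^ℕ suc n) m) (cong (ℤ._* + m) (pos-^ m (suc n)))

∣e∣<n⇒0<n+e : ∀ n e → ∣ e ∣ ℕ.< n → 0ℤ ℤ.< + n ℤ.+ e
∣e∣<n⇒0<n+e n (+ m)    m<n = ℤ.+<+ (ℕ.<-≤-trans (ℕ.≤-<-trans z≤n m<n) (ℕ.m≤m+n n m))
∣e∣<n⇒0<n+e n -[1+ m ] m<n =
  subst (0ℤ ℤ.<_) (sym (ℤ.⊖-≥ (ℕ.<⇒≤ m<n))) (ℤ.+<+ (ℕ.m<n⇒0<n∸m m<n))

s<t⇒s*p<t*q : ∀ {s t p q} → s ℕ.< t → p ℤ.≤ q → 0ℤ ℤ.< q → + s ℤ.* p ℤ.< + t ℤ.* q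
s<t⇒s*p<t*q {s} {t} {p} {q} s<t p≤q 0<q =
  ℤ.≤-<-trans (ℤ.*-monoˡ-≤-nonNeg (+ s) p≤q) (ℤ.*-monoʳ-<-pos q {{ℤ.positive 0<q}} (ℤ.+<+ s<t))

i*i≡∣i∣*∣i∣ : ∀ i → i ℤ.* i ≡ + ∣ i ∣ ℤ.* + ∣ i ∣
i*i≡∣i∣*∣i∣ (+ n)    = refl
i*i≡∣i∣*∣i∣ -[1+ n ] = refl

i*[i*k]⁵≡[i*i]³*k⁵ : ∀ i k → i ℤ.* (i ℤ.* k) ^ℤ 5 ≡ (i ℤ.* i) ^ℤ 3 ℤ.* k ^ℤ 5
i*[i*k]⁵≡[i*i]³*k⁵ = solve-∀ ℤ-Solver.ring

m≤m^[1+n] : ∀ m n .{{_ : ℕ.NonZero m}} → m ℕ.≤ m ^ℕ suc n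
m≤m^[1+n] m zero    = ℕ.≤-refl
m≤m^[1+n] m (suc n) = ℕ.≤-trans (m≤m^[1+n] m n) (ℕ.m≤m*n (m ^ℕ suc n) m)

^-monoˡ-≤ : ∀ k {m n} → m ℕ.≤ n → m ^ℕ k ℕ.≤ n ^ℕ k
^-monoˡ-≤ 0             m≤n = ℕ.≤-refl
^-monoˡ-≤ 1             m≤n = m≤n
^-monoˡ-≤ (suc (suc k)) m≤n = ℕ.*-mono-≤ (^-monoˡ-≤ (suc k) m≤n) m≤n

m+r<t⇒m*x+r<t*x : ∀ m r t x .{{_ : ℕ.NonZero x}} → m ℕ.+ r ℕ.< t → m ℕ.* x ℕ.+ r ℕ.< t ℕ.* x
m+r<t⇒m*x+r<t*x m r t x m+r<t = begin-strict
  m ℕ.* x ℕ.+ r          ≤⟨ ℕ.+-monoʳ-≤ (m ℕ.* x) (ℕ.m≤m*n r x) ⟩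
  m ℕ.* x ℕ.+ r ℕ.* x    ≡⟨ ℕ.*-distribʳ-+ x m r ⟨
  (m ℕ.+ r) ℕ.* x        <⟨ ℕ.*-monoˡ-< x m+r<t ⟩
  t ℕ.* x                ∎
  where open ℕ.≤-Reasoning

slope : (b c u j : ℚ) → ℚ
slope b c u j = 237568 * u ^ 5 + 2 * b * j - c

intercept : (b d u j : ℚ) → ℚ
intercept b d u j = 229376 * u ^ 6 - 8 * b * u * j - d

-- The cubic x is chosen so that x² + 32u(z − 4u)⁵ − z⁶ = 237568u⁵z + 229376u⁶ is linear in z.
curvePoint : (u j z : ℚ) → ℚ × ℚ × ℚ
curvePoint u j z = z ^ 3 - 16 * u * z ^ 2 + 192 * u ^ 2 * z + 512 * u ^ 3 , 2 * j * (z - 4 * u) , z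

curvePoint-onSurface : ∀ a b c d {u} j z → u ≡ ℤ→ℚ a * j ^ 5 →
  slope (ℤ→ℚ b) (ℤ→ℚ c) u j * z + intercept (ℤ→ℚ b) (ℤ→ℚ d) u j ≡ 0ℚ →
  OnSurface a b c d (curvePoint u j z)
curvePoint-onSurface a b c d j z refl root =
  trans (restriction (ℤ→ℚ a) (ℤ→ℚ b) (ℤ→ℚ c) (ℤ→ℚ d) j z)
        (trans (cong (_+_ (ℤ→ℚ d)) root) (ℚ.+-identityʳ (ℤ→ℚ d)))
  where
  restriction : ∀ (a b c d j z : ℚ) →
    let u = a * j ^ 5
        x = z ^ 3 - 16 * u * z ^ 2 + 192 * u ^ 2 * z + 512 * u ^ 3
        y = 2 * j * (z - 4 * u)
    in x * x + a * y ^ 5 + b * y - (z ^ 6 + c * z)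
       ≡ d + ((237568 * u ^ 5 + 2 * b * j - c) * z + (229376 * u ^ 6 - 8 * b * u * j - d))
  restriction = solve-∀ ℚ-ring

root-of-linear : ∀ p q .{{_ : ℚ.NonZero p}} → p * (- q * 1/ p) + q ≡ 0ℚ
root-of-linear p q = begin
  p * (- q * 1/ p) + q   ≡⟨ rearrange p q (1/ p) ⟩
  q * (1 - p * 1/ p)     ≡⟨ cong (λ r → q * (1 - r)) (ℚ.*-inverseʳ p) ⟩
  q * 0ℚ                 ≡⟨ ℚ.*-zeroʳ q ⟩
  0ℚ                     ∎
  where
  open ≡-Reasoning
  rearrange : ∀ p q r → p * (- q * r) + q ≡ q * (1 - p * r)
  rearrange = solve-∀ ℚ-ring

height-identity : ∀ c₀ c₁ j u z →
  c₁ * (2 * j * (z - 4 * u)) + 2 * (j * (c₀ + 4 * u * c₁)) ≡ 2 * j * (c₁ * z + c₀)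
height-identity = solve-∀ ℚ-ring

module Family (a b c d : ℤ) where

  j u c₁ c₀ : ℕ → ℤ
  j t  = a ℤ.* + t
  u t  = a ℤ.* j t ^ℤ 5
  c₁ t = + 237568 ℤ.* u t ^ℤ 5 ℤ.+ + 2 ℤ.* b ℤ.* j t ℤ.- c
  c₀ t = + 229376 ℤ.* u t ^ℤ 6 ℤ.- + 8 ℤ.* b ℤ.* u t ℤ.* j t ℤ.- d

  J U C₁ C₀ : ℕ → ℚ
  J t  = ℤ→ℚ (j t)
  U t  = ℤ→ℚ (u t)
  C₁ t = ℤ→ℚ (c₁ t)
  C₀ t = ℤ→ℚ (c₀ t)

  U≡a*J⁵ : ∀ t → U t ≡ ℤ→ℚ a * J t ^ 5
  U≡a*J⁵ t = trans (ℤ→ℚ-* a (j t ^ℤ 5)) (cong (ℤ→ℚ a *_) (ℤ→ℚ-^ (j t) 5))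

  C₁≡slope : ∀ t → C₁ t ≡ slope (ℤ→ℚ b) (ℤ→ℚ c) (U t) (J t)
  C₁≡slope t = begin
    ℤ→ℚ (p ℤ.+ q ℤ.- c)       ≡⟨ ℤ→ℚ-- (p ℤ.+ q) c ⟩
    ℤ→ℚ (p ℤ.+ q) - ℤ→ℚ c     ≡⟨ cong (_- ℤ→ℚ c) (ℤ→ℚ-+ p q) ⟩
    ℤ→ℚ p + ℤ→ℚ q - ℤ→ℚ c     ≡⟨ cong₂ (λ x y → x + y - ℤ→ℚ c) p≡ q≡ ⟩
    slope (ℤ→ℚ b) (ℤ→ℚ c) (U t) (J t) ∎
    where
    open ≡-Reasoning
    p = + 237568 ℤ.* u t ^ℤ 5
    q = + 2 ℤ.* b ℤ.* j t
    p≡ : ℤ→ℚ p ≡ 237568 * U t ^ 5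
    p≡ = trans (ℤ→ℚ-* (+ 237568) (u t ^ℤ 5)) (cong (237568 *_) (ℤ→ℚ-^ (u t) 5))
    q≡ : ℤ→ℚ q ≡ 2 * ℤ→ℚ b * J t
    q≡ = trans (ℤ→ℚ-* (+ 2 ℤ.* b) (j t)) (cong (_* J t) (ℤ→ℚ-* (+ 2) b))

  C₀≡intercept : ∀ t → C₀ t ≡ intercept (ℤ→ℚ b) (ℤ→ℚ d) (U t) (J t)
  C₀≡intercept t = begin
    ℤ→ℚ (p ℤ.- q ℤ.- d)       ≡⟨ ℤ→ℚ-- (p ℤ.- q) d ⟩
    ℤ→ℚ (p ℤ.- q) - ℤ→ℚ d     ≡⟨ cong (_- ℤ→ℚ d) (ℤ→ℚ-- p q) ⟩
    ℤ→ℚ p - ℤ→ℚ q - ℤ→ℚ d     ≡⟨ cong₂ (λ x y → x - y - ℤ→ℚ d) p≡ q≡ ⟩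
    intercept (ℤ→ℚ b) (ℤ→ℚ d) (U t) (J t) ∎
    where
    open ≡-Reasoning
    p = + 229376 ℤ.* u t ^ℤ 6
    q = + 8 ℤ.* b ℤ.* u t ℤ.* j t
    p≡ : ℤ→ℚ p ≡ 229376 * U t ^ 6
    p≡ = trans (ℤ→ℚ-* (+ 229376) (u t ^ℤ 6)) (cong (229376 *_) (ℤ→ℚ-^ (u t) 6))
    q≡ : ℤ→ℚ q ≡ 8 * ℤ→ℚ b * U t * J t
    q≡ = trans (ℤ→ℚ-* (+ 8 ℤ.* b ℤ.* u t) (j t))
               (cong (_* J t) (trans (ℤ→ℚ-* (+ 8 ℤ.* b) (u t)) (cong (_* U t) (ℤ→ℚ-* (+ 8) b))))

  -- On the curve over the root z of C₁(t) z + C₀(t), the height at parameter r is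
  -- y = −2 j(r) w(t, r) / C₁(t).
  w : ℕ → ℕ → ℤ
  w t r = c₀ t ℤ.+ + 4 ℤ.* u r ℤ.* c₁ t

  ℤ→ℚ-2jw : ∀ t r → ℤ→ℚ (+ 2 ℤ.* (j r ℤ.* w t r)) ≡ 2 * (J r * (C₀ t + 4 * U r * C₁ t))
  ℤ→ℚ-2jw t r =
    trans (ℤ→ℚ-* (+ 2) (j r ℤ.* w t r))
     (cong (2 *_) (trans (ℤ→ℚ-* (j r) (w t r))
      (cong (J r *_) (trans (ℤ→ℚ-+ (c₀ t) (+ 4 ℤ.* u r ℤ.* c₁ t))
       (cong (_+_ (C₀ t)) (trans (ℤ→ℚ-* (+ 4 ℤ.* u r) (c₁ t))
        (cong (_* C₁ t) (ℤ→ℚ-* (+ 4) (u r)))))))))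

  module NonDegenerate (a≢0 : ¬ a ≡ 0ℤ) where

    A B C D K : ℕ
    A = ∣ a ∣
    B = ∣ b ∣
    C = ∣ c ∣
    D = ∣ d ∣
    K = 8 ℕ.* B ℕ.+ C ℕ.+ D

    instance
      A≢0 : ℕ.NonZero A
      A≢0 = ℕ.≢-nonZero (a≢0 ∘ ℤ.∣i∣≡0⇒i≡0)

    N ũ : ℕ → ℕ
    N t = A ℕ.* t
    ũ t = A ℕ.* N t ^ℕ 5

    u≡ũ : ∀ t → u t ≡ + ũ t
    u≡ũ t = begin
      a ℤ.* (a ℤ.* + t) ^ℤ 5              ≡⟨ i*[i*k]⁵≡[i*i]³*k⁵ a (+ t) ⟩
      (a ℤ.* a) ^ℤ 3 ℤ.* (+ t) ^ℤ 5        ≡⟨ cong (λ s → s ^ℤ 3 ℤ.* (+ t) ^ℤ 5) (i*i≡∣i∣*∣i∣ a) ⟩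
      (+ A ℤ.* + A) ^ℤ 3 ℤ.* (+ t) ^ℤ 5    ≡⟨ i*[i*k]⁵≡[i*i]³*k⁵ (+ A) (+ t) ⟨
      + A ℤ.* (+ A ℤ.* + t) ^ℤ 5           ≡⟨ cong (λ s → + A ℤ.* s ^ℤ 5) (ℤ.pos-* A t) ⟨
      + A ℤ.* (+ N t) ^ℤ 5                 ≡⟨ cong (+ A ℤ.*_) (pos-^ (N t) 5) ⟨
      + A ℤ.* + (N t ^ℕ 5)                 ≡⟨ ℤ.pos-* A (N t ^ℕ 5) ⟨
      + ũ t                                ∎
      where open ≡-Reasoning

    u-mono : ∀ {s t} → s ℕ.≤ t → u s ℤ.≤ u t
    u-mono {s} {t} s≤t = subst₂ ℤ._≤_ (sym (u≡ũ s)) (sym (u≡ũ t))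
      (ℤ.+≤+ (ℕ.*-monoʳ-≤ A (^-monoˡ-≤ 5 (ℕ.*-monoʳ-≤ A s≤t))))

    κ*u^n≡κ*ũ^n : ∀ κ n t → + κ ℤ.* u t ^ℤ n ≡ + (κ ℕ.* ũ t ^ℕ n)
    κ*u^n≡κ*ũ^n κ n t = begin
      + κ ℤ.* u t ^ℤ n             ≡⟨ cong (λ v → + κ ℤ.* v ^ℤ n) (u≡ũ t) ⟩
      + κ ℤ.* (+ ũ t) ^ℤ n         ≡⟨ cong (+ κ ℤ.*_) (pos-^ (ũ t) n) ⟨
      + κ ℤ.* + (ũ t ^ℕ n)         ≡⟨ ℤ.pos-* κ (ũ t ^ℕ n) ⟨
      + (κ ℕ.* ũ t ^ℕ n)           ∎
      where open ≡-Reasoning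

    module _ (t : ℕ) (K<t : K ℕ.< t) where

      instance
        t≢0 : ℕ.NonZero t
        t≢0 = ℕ.>-nonZero (ℕ.≤-<-trans z≤n K<t)
        N≢0 : ℕ.NonZero (N t)
        N≢0 = ℕ.m*n≢0 A t

      t*N≤ũ : t ℕ.* N t ℕ.≤ ũ t
      t*N≤ũ = ℕ.≤-trans (ℕ.*-monoˡ-≤ (N t) t≤A*N⁴)
                        (ℕ.≤-reflexive (ℕ.*-assoc A (N t ^ℕ 4) (N t)))
        where
        t≤A*N⁴ : t ℕ.≤ A ℕ.* N t ^ℕ 4
        t≤A*N⁴ = ℕ.≤-trans (ℕ.m≤n*m t A) (ℕ.≤-trans (m≤m^[1+n] (N t) 3) (ℕ.m≤n*m _ A))

      instance
        ũ≢0 : ℕ.NonZero (ũ t)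
        ũ≢0 = ℕ.>-nonZero (ℕ.<-≤-trans (ℕ.>-nonZero⁻¹ (t ℕ.* N t) {{ℕ.m*n≢0 t (N t)}}) t*N≤ũ)

      c₁-positive : 0ℤ ℤ.< c₁ t
      c₁-positive = subst (0ℤ ℤ.<_) (sym c₁≡) (∣e∣<n⇒0<n+e _ e e-small)
        where
        e = + 2 ℤ.* b ℤ.* j t ℤ.- c
        c₁≡ : c₁ t ≡ + (237568 ℕ.* ũ t ^ℕ 5) ℤ.+ e
        c₁≡ = trans (ℤ.+-assoc (+ 237568 ℤ.* u t ^ℤ 5) (+ 2 ℤ.* b ℤ.* j t) (ℤ.- c))
                    (cong (ℤ._+ e) (κ*u^n≡κ*ũ^n 237568 5 t))
        2B+C<t : 2 ℕ.* B ℕ.+ C ℕ.< t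
        2B+C<t = ℕ.≤-<-trans (ℕ.≤-trans (ℕ.+-monoˡ-≤ C (ℕ.*-monoˡ-≤ B {2} {8} (ℕ.s≤s (ℕ.s≤s z≤n))))
                                         (ℕ.m≤m+n _ D)) K<t
        e-small : ∣ e ∣ ℕ.< 237568 ℕ.* ũ t ^ℕ 5
        e-small = begin-strict
          ∣ e ∣                          ≤⟨ ℤ.∣i-j∣≤∣i∣+∣j∣ (+ 2 ℤ.* b ℤ.* j t) c ⟩
          ∣ + 2 ℤ.* b ℤ.* j t ∣ ℕ.+ C    ≡⟨ cong (ℕ._+ C) (trans (ℤ.abs-* (+ 2 ℤ.* b) (j t))
                                               (cong₂ ℕ._*_ (ℤ.abs-* (+ 2) b) (ℤ.abs-* a (+ t)))) ⟩
          2 ℕ.* B ℕ.* N t ℕ.+ C          <⟨ m+r<t⇒m*x+r<t*x (2 ℕ.* B) C t (N t) 2B+C<t ⟩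
          t ℕ.* N t                      ≤⟨ t*N≤ũ ⟩
          ũ t                            ≤⟨ m≤m^[1+n] (ũ t) 4 ⟩
          ũ t ^ℕ 5                       ≤⟨ ℕ.m≤n*m _ 237568 ⟩
          237568 ℕ.* ũ t ^ℕ 5            ∎
          where open ℕ.≤-Reasoning

      c₀-positive : 0ℤ ℤ.< c₀ t
      c₀-positive = subst (0ℤ ℤ.<_) (sym c₀≡) (∣e∣<n⇒0<n+e _ e e-small)
        where
        x = + 8 ℤ.* b ℤ.* u t ℤ.* j t
        e = ℤ.- x ℤ.- d
        c₀≡ : c₀ t ≡ + (229376 ℕ.* ũ t ^ℕ 6) ℤ.+ e
        c₀≡ = trans (ℤ.+-assoc (+ 229376 ℤ.* u t ^ℤ 6) (ℤ.- x) (ℤ.- d))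
                    (cong (ℤ._+ e) (κ*u^n≡κ*ũ^n 229376 6 t))
        8B+D<t : 8 ℕ.* B ℕ.+ D ℕ.< t
        8B+D<t = ℕ.≤-<-trans (ℕ.+-monoˡ-≤ D (ℕ.m≤m+n _ C)) K<t
        ∣x∣ : ∣ x ∣ ≡ 8 ℕ.* B ℕ.* ũ t ℕ.* N t
        ∣x∣ = trans (ℤ.abs-* (+ 8 ℤ.* b ℤ.* u t) (j t))
                (cong₂ ℕ._*_ (trans (ℤ.abs-* (+ 8 ℤ.* b) (u t))
                                    (cong₂ ℕ._*_ (ℤ.abs-* (+ 8) b) (cong ∣_∣ (u≡ũ t))))
                             (ℤ.abs-* a (+ t)))
        e-small : ∣ e ∣ ℕ.< 229376 ℕ.* ũ t ^ℕ 6
        e-small = begin-strict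
          ∣ e ∣                              ≤⟨ ℤ.∣i-j∣≤∣i∣+∣j∣ (ℤ.- x) d ⟩
          ∣ ℤ.- x ∣ ℕ.+ D                    ≡⟨ cong (ℕ._+ D) (trans (ℤ.∣-i∣≡∣i∣ x) ∣x∣) ⟩
          8 ℕ.* B ℕ.* ũ t ℕ.* N t ℕ.+ D      ≡⟨ cong (ℕ._+ D) (ℕ.*-assoc (8 ℕ.* B) (ũ t) (N t)) ⟩
          8 ℕ.* B ℕ.* (ũ t ℕ.* N t) ℕ.+ D    <⟨ m+r<t⇒m*x+r<t*x (8 ℕ.* B) D t (ũ t ℕ.* N t)
                                                  {{ℕ.m*n≢0 (ũ t) (N t)}} 8B+D<t ⟩
          t ℕ.* (ũ t ℕ.* N t)                ≡⟨ x∙yz≈y∙xz t (ũ t) (N t) ⟩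
          ũ t ℕ.* (t ℕ.* N t)                ≤⟨ ℕ.*-monoʳ-≤ (ũ t) t*N≤ũ ⟩
          ũ t ℕ.* ũ t                        ≤⟨ ℕ.*-monoˡ-≤ (ũ t) (m≤m^[1+n] (ũ t) 4) ⟩
          ũ t ^ℕ 6                           ≤⟨ ℕ.m≤n*m _ 229376 ⟩
          229376 ℕ.* ũ t ^ℕ 6                ∎
          where open ℕ.≤-Reasoning

      instance
        C₁≢0 : ℚ.NonZero (C₁ t)
        C₁≢0 = ℚ.≢-nonZero (ℤ.<⇒≢ c₁-positive ∘ sym ∘ ℤ→ℚ-injective {c₁ t} {0ℤ})

      root : ℚ
      root = - C₀ t * 1/ C₁ t

      point : ℚ × ℚ × ℚ
      point = curvePoint (U t) (J t) root

      point-onSurface : OnSurface a b c d point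
      point-onSurface = curvePoint-onSurface a b c d (J t) root (U≡a*J⁵ t)
        (subst₂ (λ p q → p * root + q ≡ 0ℚ) (C₁≡slope t) (C₀≡intercept t)
                (root-of-linear (C₁ t) (C₀ t)))

      height-over-root : ∀ r →
        C₁ t * (2 * J r * (root - 4 * U r)) + 2 * (J r * (C₀ t + 4 * U r * C₁ t)) ≡ 0ℚ
      height-over-root r =
        trans (height-identity (C₀ t) (C₁ t) (J r) (U r) root)
              (trans (cong (2 * J r *_) (root-of-linear (C₁ t) (C₀ t))) (ℚ.*-zeroʳ (2 * J r)))

      s*w<t*w : ∀ {s} → s ℕ.< t → + s ℤ.* w t s ℤ.< + t ℤ.* w t t
      s*w<t*w {s} s<t = s<t⇒s*p<t*q s<t w-mono w-pos
        where
        c₁≥0 = ℤ.nonNegative (ℤ.<⇒≤ c₁-positive)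
        w-mono : w t s ℤ.≤ w t t
        w-mono = ℤ.+-monoʳ-≤ (c₀ t) (ℤ.*-monoʳ-≤-nonNeg (c₁ t) {{c₁≥0}}
                   (ℤ.*-monoˡ-≤-nonNeg (+ 4) (u-mono (ℕ.<⇒≤ s<t))))
        w-pos : 0ℤ ℤ.< w t t
        w-pos = ℤ.+-mono-<-≤ c₀-positive (ℤ.*-monoʳ-≤-nonNeg (c₁ t) {{c₁≥0}}
                  (ℤ.*-monoˡ-≤-nonNeg (+ 4) (subst (0ℤ ℤ.≤_) (sym (u≡ũ t)) (ℤ.+≤+ z≤n))))

    equal-points⇒s*w≡t*w : ∀ {s t} (K<s : K ℕ.< s) (K<t : K ℕ.< t) →
      point s K<s ≡ point t K<t → + s ℤ.* w t s ≡ + t ℤ.* w t t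
    equal-points⇒s*w≡t*w {s} {t} K<s K<t eq =
      ℤ.*-cancelˡ-≡ a (+ s ℤ.* w t s) (+ t ℤ.* w t t) {{ℤ.≢-nonZero a≢0}}
        (trans (sym (ℤ.*-assoc a (+ s) (w t s))) (trans js*w≡jt*w (ℤ.*-assoc a (+ t) (w t t))))
      where
      z = root t K<t
      Y≡ : 2 * J s * (z - 4 * U s) ≡ 2 * J t * (z - 4 * U t)
      Y≡ = trans (cong (λ z′ → 2 * J s * (z′ - 4 * U s)) (sym (cong (proj₂ ∘ proj₂) eq)))
                 (cong (proj₁ ∘ proj₂) eq)
      heights : 2 * (J s * (C₀ t + 4 * U s * C₁ t)) ≡ 2 * (J t * (C₀ t + 4 * U t * C₁ t))
      heights = +-cancelˡ (C₁ t * (2 * J t * (z - 4 * U t)))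
        (2 * (J s * (C₀ t + 4 * U s * C₁ t))) (2 * (J t * (C₀ t + 4 * U t * C₁ t)))
        (trans (cong (λ y → C₁ t * y + 2 * (J s * (C₀ t + 4 * U s * C₁ t))) (sym Y≡))
               (trans (height-over-root t K<t s) (sym (height-over-root t K<t t))))
      js*w≡jt*w : j s ℤ.* w t s ≡ j t ℤ.* w t t
      js*w≡jt*w = ℤ.*-cancelˡ-≡ (+ 2) (j s ℤ.* w t s) (j t ℤ.* w t t)
        (ℤ→ℚ-injective {+ 2 ℤ.* (j s ℤ.* w t s)} {+ 2 ℤ.* (j t ℤ.* w t t)}
          (trans (ℤ→ℚ-2jw t s) (trans heights (sym (ℤ→ℚ-2jw t t)))))

    points-separated : ∀ {s t} (K<s : K ℕ.< s) (K<t : K ℕ.< t) → s ℕ.< t → point s K<s ≢ point t K<t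
    points-separated {s} {t} K<s K<t s<t eq =
      ℤ.<⇒≢ {+ s ℤ.* w t s} {+ t ℤ.* w t t} (s*w<t*w t K<t s<t) (equal-points⇒s*w≡t*w K<s K<t eq)

    point-injective : ∀ s t (K<s : K ℕ.< s) (K<t : K ℕ.< t) → point s K<s ≡ point t K<t → s ≡ t
    point-injective s t K<s K<t eq = by-trichotomy (ℕ.<-cmp s t)
      where
      by-trichotomy : Tri (s ℕ.< t) (s ≡ t) (t ℕ.< s) → s ≡ t
      by-trichotomy (tri< s<t _ _) = ⊥-elim (points-separated K<s K<t s<t eq)
      by-trichotomy (tri≈ _ s≡t _) = s≡t
      by-trichotomy (tri> _ _ t<s) = ⊥-elim (points-separated K<t K<s t<s (sym eq))

    τ : ℕ → ℕ
    τ n = suc K ℕ.+ n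

    K<τ : ∀ n → K ℕ.< τ n
    K<τ n = ℕ.m≤m+n (suc K) n

    P : ℕ → ℚ × ℚ × ℚ
    P n = point (τ n) (K<τ n)

    P-onSurface : ∀ n → OnSurface a b c d (P n)
    P-onSurface n = point-onSurface (τ n) (K<τ n)

    P-injective : Injective _≡_ _≡_ P
    P-injective {m} {n} eq = ℕ.+-cancelˡ-≡ (suc K) m n (point-injective (τ m) (τ n) (K<τ m) (K<τ n) eq)

corollary4 : (a b c d : ℤ) → ¬ (a ≡ 0ℤ) →
    Σ (ℕ → ℚ × ℚ × ℚ) λ p → ((n : ℕ) → OnSurface a b c d (p n)) × Injective _≡_ _≡_ p
corollary4 a b c d a≢0 = P , P-onSurface , P-injective
  where open Family.NonDegenerate a b c d a≢0
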